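{- Let $n\ge1$. The average value of $\mathrm{nse}(\pi)$ over all $\pi\in\mathrm{SLP}_n$ equals $$\frac{\sum_{j=0}^{n-1}j\left[ {n\atop n-j}\right]B_{n-j}}{\sum_{k=0}^{n}\left[ {n\atop k}\right]B_k}.$$
   Context: $[n]=\{1,\dots,n\}$. $\mathrm{SLP}_n$ is the set of all partitions of $[n]$ into nonempty blocks where each block is a linear list of its elements and the blocks are unordered ("sets of lists"), with any number of blocks. For $\pi\in\mathrm{SLP}_n$, $\mathrm{nse}(\pi)$ is the total, over all blocks, of the number of elements that must be moved to the right within their list to make it increasing, i.e. the number of entries of a list having some smaller entry to their right in the same list. $\left[ {n\atop m}\right]$ denotes the unsigned Stirling number of the first kind and $B_m$ the $m$th Bell number. -}

module Defs where

open import Data.Nat using (ℕ; zero; suc; _+_; _*_; _<_; _<ᵇ_)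
open import Data.List using (List; []; _∷_; map; upTo; concat; length)
open import Data.Nat.ListAction using (sum)
open import Data.Bool.ListAction using (any)
open import Data.List.Relation.Unary.All using (All)
open import Data.List.Relation.Unary.Unique.Propositional using (Unique)
open import Data.List.Relation.Binary.Permutation.Propositional using (_↭_)
open import Data.List.Membership.Propositional using (_∈_)
open import Data.List.Relation.Unary.Linked using (Linked)
open import Data.Product using (_×_)
open import Data.Bool using (if_then_else_)
open import Function.Bundles using (_⇔_)

stir1 : ℕ → ℕ → ℕ
stir1 zero    zero    = 1
stir1 zero    (suc k) = 0
stir1 (suc n) zero    = 0
stir1 (suc n) (suc k) = n * stir1 n (suc k) + stir1 n k

stir2 : ℕ → ℕ → ℕ
stir2 zero    zero    = 1
stir2 zero    (suc k) = 0
stir2 (suc n) zero    = 0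
stir2 (suc n) (suc k) = suc k * stir2 n (suc k) + stir2 n k

bell : ℕ → ℕ
bell m = sum (map (stir2 m) (upTo (suc m)))

-- a list (block) and a set of lists represented as a list of blocks
Block : Set
Block = List ℕ

SL : Set
SL = List Block

nseBlock : Block → ℕ
nseBlock []       = 0
nseBlock (x ∷ xs) = (if any (λ y → y <ᵇ x) xs then 1 else 0) + nseBlock xs

nse : SL → ℕ
nse π = sum (map nseBlock π)

range1 : ℕ → List ℕ
range1 n = map suc (upTo n)

data NonEmpty : Block → Set where
  nonEmpty : ∀ x xs → NonEmpty (x ∷ xs)

-- ordering of blocks by their first entries (used only to pick a canonical
-- representative of the unordered collection of blocks)
data HeadLt : Block → Block → Set where
  headLt : ∀ {x y xs ys} → x < y → HeadLt (x ∷ xs) (y ∷ ys)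

IsSLP : ℕ → SL → Set
IsSLP n π = All NonEmpty π × (concat π ↭ range1 n) × Linked HeadLt π

Enumerates : ℕ → List SL → Set
Enumerates n L = Unique L × (∀ π → (π ∈ L) ⇔ IsSLP n π)

numer : ℕ → ℕ
numer n = sum (map (λ j → j * stir1 n (n Data.Nat.∸ j) * bell (n Data.Nat.∸ j)) (upTo n))

denom : ℕ → ℕ
denom n = sum (map (λ k → stir1 n k * bell k) (upTo (suc n)))

module Submission where

-- For a weight f on the number of blocks put A_n(f) = Σ_{π ∈ SLP_n} f(#blocks π) and
-- B_n(f) = Σ_{π ∈ SLP_n} nse(π) f(#blocks π).  Every π ∈ SLP_{n+1} arises from exactly
-- one σ ∈ SLP_n by inserting n + 1: as a new singleton block, in front of one of the k
-- blocks of σ, or right after one of its n entries.  The singleton adds a block, the other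
-- n + k ways keep k blocks; the new maximum never makes an old entry misplaced, and is
-- itself misplaced exactly in the n positions directly before an old entry.  Hence
--   A_{n+1}(f) = A_n(grow n f),   B_{n+1}(f) = B_n(grow n f) + n A_n(f),
-- where grow n f k = (n + k) f(k) + f(k + 1).  With P_j(f) = Σ_k {j k} f(k) the Stirling
-- recurrences give A_n(f) = Σ_j [n j] P_j(f) and B_n(f) = Σ_j (n - j) [n j] P_j(f);
-- for f ≡ 1, P_j(1) = B_j, so |SLP_n| = denom n and Σ_π nse(π) = numer n.

open import Defs
open import Data.Bool using (true; false; if_then_else_; _∨_)
open import Data.Bool.Properties using (T-≡)
open import Data.Bool.ListAction using (any)
open import Data.Empty using (⊥; ⊥-elim)
open import Data.List using (List; []; _∷_; [_]; _++_; map; length; concat; concatMap; upTo; applyUpTo; null)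
open import Data.List.Properties using (map-upTo; map-++; map-∘; length-++; length-map; upTo-∷ʳ; length-upTo; concat-++; ++-assoc; ++-identityʳ; ∷-injectiveˡ; ∷-injectiveʳ)
open import Data.List.Membership.Propositional using (_∈_; find; lose)
open import Data.List.Membership.Propositional.Properties using (∈-map⁻; ∈-map⁺; ∈-++⁻; ∈-++⁺ˡ; ∈-++⁺ʳ; ∈-concat⁺′; ∈-concat⁻′; ∈-∃++; ∈-concatMap⁺; ∈-concatMap⁻)
open import Data.List.Relation.Unary.All as All using (All; []; _∷_)
import Data.List.Relation.Unary.All.Properties as AllP
open import Data.List.Relation.Unary.Any using (here; there)
open import Data.List.Relation.Unary.AllPairs using (AllPairs; []; _∷_)
import Data.List.Relation.Unary.AllPairs.Properties as AllPairs
open import Data.List.Relation.Unary.Linked as Linked using (Linked; []; [-]; _∷_)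
open import Data.List.Relation.Unary.Linked.Properties using (Linked⇒AllPairs; AllPairs⇒Linked)
open import Data.List.Relation.Unary.Unique.Propositional using (Unique)
import Data.List.Relation.Unary.Unique.Propositional.Properties as Unique
open import Data.List.Relation.Binary.Permutation.Propositional using (_↭_; ↭-refl; ↭-sym; ↭-trans; ↭-reflexive; ↭⇒↭ₛ)
open import Data.List.Relation.Binary.Permutation.Propositional.Properties using (drop-∷; ∷↭∷ʳ; ++-comm; shift; ++⁺ˡ; ++⁺ʳ; ∈-resp-↭; All-resp-↭; ↭-length; ↭-empty-inv; map⁺)
open import Data.List.Relation.Binary.BagAndSetEquality using (∼bag⇒↭)
open import Data.List.Membership.Propositional.Properties.WithK using (unique∧set⇒bag)
import Data.List.Relation.Binary.Permutation.Setoid.Properties as PermSetoid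
open import Data.Nat using (ℕ; zero; suc; _+_; _*_; _∸_; _≤_; _<_; _<ᵇ_; z≤n; s≤s; s≤s⁻¹)
open import Data.Nat.Properties
open import Data.Nat.ListAction using (sum)
open import Data.Nat.ListAction.Properties using (sum-++; sum-↭)
open import Data.Nat.Tactic.RingSolver using (solve-∀)
open import Data.Product using (∃; ∃₂; _×_; _,_; proj₁; proj₂)
open import Data.Sum using (inj₁; inj₂)
open import Function using (_∘_)
open import Function.Bundles using (Equivalence; mk⇔)
open import Relation.Binary.PropositionalEquality hiding ([_])
open import Relation.Nullary using (yes; no; ¬_)

open ≡-Reasoning

private variable A B : Set

+-interchange : ∀ a b c d → a + b + (c + d) ≡ a + c + (b + d)
+-interchange = solve-∀

x*[a*y]≡a*[x*y] : ∀ x a y → x * (a * y) ≡ a * (x * y)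
x*[a*y]≡a*[x*y] = solve-∀

sum-map-cong : ∀ (xs : List A) {f g : A → ℕ} → (∀ x → x ∈ xs → f x ≡ g x) →
  sum (map f xs) ≡ sum (map g xs)
sum-map-cong []       e = refl
sum-map-cong (x ∷ xs) e = cong₂ _+_ (e x (here refl)) (sum-map-cong xs (λ y y∈xs → e y (there y∈xs)))

sum-map-++ : ∀ (f : A → ℕ) xs ys → sum (map f (xs ++ ys)) ≡ sum (map f xs) + sum (map f ys)
sum-map-++ f xs ys = trans (cong sum (map-++ f xs ys)) (sum-++ (map f xs) (map f ys))

sum-map-+ : ∀ (xs : List A) (f g : A → ℕ) →
  sum (map (λ x → f x + g x) xs) ≡ sum (map f xs) + sum (map g xs)
sum-map-+ []       f g = refl
sum-map-+ (x ∷ xs) f g = trans (cong (f x + g x +_) (sum-map-+ xs f g)) (+-interchange (f x) (g x) _ _)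

sum-map-*ˡ : ∀ (xs : List A) c (f : A → ℕ) → sum (map (λ x → c * f x) xs) ≡ c * sum (map f xs)
sum-map-*ˡ []       c f = sym (*-zeroʳ c)
sum-map-*ˡ (x ∷ xs) c f = trans (cong (c * f x +_) (sum-map-*ˡ xs c f))
                                (sym (*-distribˡ-+ c (f x) (sum (map f xs))))

sum-map-*ʳ : ∀ (xs : List A) c (f : A → ℕ) → sum (map (λ x → f x * c) xs) ≡ sum (map f xs) * c
sum-map-*ʳ xs c f = trans (sum-map-cong xs (λ x _ → *-comm (f x) c))
                          (trans (sum-map-*ˡ xs c f) (*-comm c (sum (map f xs))))

sum-map-const : ∀ (xs : List A) c → sum (map (λ _ → c) xs) ≡ length xs * c
sum-map-const []       c = refl
sum-map-const (x ∷ xs) c = cong (c +_) (sum-map-const xs c)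

sum-map-+const : ∀ (xs : List A) c (f : A → ℕ) →
  sum (map (λ x → c + f x) xs) ≡ length xs * c + sum (map f xs)
sum-map-+const xs c f = trans (sum-map-+ xs (λ _ → c) f) (cong (_+ sum (map f xs)) (sum-map-const xs c))

sum-map-∘ : ∀ (xs : List A) (g : A → B) (f : B → ℕ) →
  sum (map f (map g xs)) ≡ sum (map (f ∘ g) xs)
sum-map-∘ xs g f = cong sum (sym (map-∘ {g = f} {f = g} xs))

sum-concatMap : ∀ (g : A → List B) (f : B → ℕ) xs →
  sum (map f (concatMap g xs)) ≡ sum (map (λ x → sum (map f (g x))) xs)
sum-concatMap g f []       = refl
sum-concatMap g f (x ∷ xs) = trans (sum-map-++ f (g x) (concatMap g xs))
                                   (cong (sum (map f (g x)) +_) (sum-concatMap g f xs))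

-- Σ_{j<m} f j.  Splitting off the term j = 0 is definitional.
sumBelow : ℕ → (ℕ → ℕ) → ℕ
sumBelow m f = sum (applyUpTo f m)

sum-upTo : ∀ m (f : ℕ → ℕ) → sum (map f (upTo m)) ≡ sumBelow m f
sum-upTo m f = cong sum (map-upTo f m)

sumBelow-cong< : ∀ m {f g : ℕ → ℕ} → (∀ j → j < m → f j ≡ g j) → sumBelow m f ≡ sumBelow m g
sumBelow-cong< zero    e = refl
sumBelow-cong< (suc m) e = cong₂ _+_ (e 0 (s≤s z≤n)) (sumBelow-cong< m (λ j j<m → e (suc j) (s≤s j<m)))

sumBelow-cong : ∀ m {f g : ℕ → ℕ} → (∀ j → f j ≡ g j) → sumBelow m f ≡ sumBelow m g
sumBelow-cong m e = sumBelow-cong< m (λ j _ → e j)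

sumBelow-+ : ∀ m (f g : ℕ → ℕ) → sumBelow m (λ j → f j + g j) ≡ sumBelow m f + sumBelow m g
sumBelow-+ zero    f g = refl
sumBelow-+ (suc m) f g = begin
  f 0 + g 0 + sumBelow m (λ j → f (suc j) + g (suc j))  ≡⟨ cong (f 0 + g 0 +_) (sumBelow-+ m (f ∘ suc) (g ∘ suc)) ⟩
  f 0 + g 0 + (sumBelow m (f ∘ suc) + sumBelow m (g ∘ suc)) ≡⟨ +-interchange (f 0) (g 0) _ _ ⟩
  sumBelow (suc m) f + sumBelow (suc m) g                  ∎

sumBelow-* : ∀ m c (f : ℕ → ℕ) → sumBelow m (λ j → c * f j) ≡ c * sumBelow m f
sumBelow-* zero    c f = sym (*-zeroʳ c)
sumBelow-* (suc m) c f = trans (cong (c * f 0 +_) (sumBelow-* m c (f ∘ suc)))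
                               (sym (*-distribˡ-+ c (f 0) (sumBelow m (f ∘ suc))))

sumBelow-snoc : ∀ m (f : ℕ → ℕ) → sumBelow (suc m) f ≡ sumBelow m f + f m
sumBelow-snoc zero    f = +-identityʳ (f 0)
sumBelow-snoc (suc m) f = trans (cong (f 0 +_) (sumBelow-snoc m (f ∘ suc)))
                                (sym (+-assoc (f 0) (sumBelow m (f ∘ suc)) (f (suc m))))

sumBelow-dropLast : ∀ m (f : ℕ → ℕ) → f m ≡ 0 → sumBelow (suc m) f ≡ sumBelow m f
sumBelow-dropLast m f fm≡0 = trans (sumBelow-snoc m f) (trans (cong (sumBelow m f +_) fm≡0) (+-identityʳ _))

sumBelow-reverse : ∀ m (f : ℕ → ℕ) → sumBelow m f ≡ sumBelow m (λ j → f (m ∸ suc j))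
sumBelow-reverse zero    f = refl
sumBelow-reverse (suc m) f = begin
  f 0 + sumBelow m (f ∘ suc)                   ≡⟨ cong (f 0 +_) (sumBelow-reverse m (f ∘ suc)) ⟩
  f 0 + sumBelow m (λ j → f (suc (m ∸ suc j))) ≡⟨ cong (f 0 +_) (sumBelow-cong< m (λ j j<m → cong f (sym (+-∸-assoc 1 j<m)))) ⟩
  f 0 + sumBelow m (λ j → f (m ∸ j))           ≡⟨ +-comm (f 0) _ ⟩
  sumBelow m (λ j → f (m ∸ j)) + f 0           ≡⟨ cong (λ i → sumBelow m (λ j → f (m ∸ j)) + f i) (sym (n∸n≡0 m)) ⟩
  sumBelow m (λ j → f (m ∸ j)) + f (m ∸ m)     ≡⟨ sym (sumBelow-snoc m (λ j → f (m ∸ j))) ⟩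
  sumBelow (suc m) (λ j → f (m ∸ j))           ∎

stir1-vanish : ∀ n k → n < k → stir1 n k ≡ 0
stir1-vanish zero    (suc k) _       = refl
stir1-vanish (suc n) (suc k) (s≤s n<k) = trans
  (cong₂ (λ a b → n * a + b) (stir1-vanish n (suc k) (m<n⇒m<1+n n<k)) (stir1-vanish n k n<k))
  (cong (_+ 0) (*-zeroʳ n))

stir2-vanish : ∀ n k → n < k → stir2 n k ≡ 0
stir2-vanish zero    (suc k) _       = refl
stir2-vanish (suc n) (suc k) (s≤s n<k) = trans
  (cong₂ (λ a b → suc k * a + b) (stir2-vanish n (suc k) (m<n⇒m<1+n n<k)) (stir2-vanish n k n<k))
  (cong (_+ 0) (*-zeroʳ (suc k)))

stir1-zero : ∀ n → n * stir1 n 0 ≡ 0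
stir1-zero zero    = refl
stir1-zero (suc n) = *-zeroʳ (suc n)

combine : ℕ → (ℕ → ℕ) → (ℕ → ℕ) → ℕ
combine n c h = sumBelow (suc n) (λ j → c j * h j)

combine-cong : ∀ n c {h h′ : ℕ → ℕ} → (∀ j → h j ≡ h′ j) → combine n c h ≡ combine n c h′
combine-cong n c e = sumBelow-cong (suc n) (λ j → cong (c j *_) (e j))

combine-+ : ∀ n c (h h′ : ℕ → ℕ) → combine n c (λ j → h j + h′ j) ≡ combine n c h + combine n c h′
combine-+ n c h h′ = trans (sumBelow-cong (suc n) (λ j → *-distribˡ-+ (c j) (h j) (h′ j)))
                           (sumBelow-+ (suc n) (λ j → c j * h j) (λ j → c j * h′ j))

combine-* : ∀ n c a (h : ℕ → ℕ) → combine n c (λ j → a * h j) ≡ a * combine n c h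
combine-* n c a h = trans (sumBelow-cong (suc n) (λ j → x*[a*y]≡a*[x*y] (c j) a (h j)))
                          (sumBelow-* (suc n) a (λ j → c j * h j))

combine-shift : ∀ n c (h : ℕ → ℕ) → c (suc n) ≡ 0 →
  combine n c h ≡ c 0 * h 0 + combine n (c ∘ suc) (h ∘ suc)
combine-shift n c h c[n+1]≡0 = cong (c 0 * h 0 +_)
  (sym (sumBelow-dropLast n (λ j → c (suc j) * h (suc j)) (cong (_* h (suc n)) c[n+1]≡0)))

-- P_j f = Σ_k {j k} f k, so that P_j 1 is the Bell number B_j.
stir2Sum : ℕ → (ℕ → ℕ) → ℕ
stir2Sum j = combine j (stir2 j)

-- G_n h = Σ_j [n j] h j.
stir1Sum : ℕ → (ℕ → ℕ) → ℕ
stir1Sum n = combine n (stir1 n)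

-- H_n h = Σ_j (n - j) [n j] h j.
defectSum : ℕ → (ℕ → ℕ) → ℕ
defectSum n = combine n (λ j → (n ∸ j) * stir1 n j)

stir2Sum-suc : ∀ j (f : ℕ → ℕ) → stir2Sum (suc j) f ≡ stir2Sum j (λ k → k * f k + f (suc k))
stir2Sum-suc j f = begin
  sumBelow (suc j) (λ k → (suc k * stir2 j (suc k) + stir2 j k) * f (suc k))
    ≡⟨ sumBelow-cong (suc j) (λ k → regroup (suc k) (stir2 j (suc k)) (stir2 j k) (f (suc k))) ⟩
  sumBelow (suc j) (λ k → stir2 j (suc k) * (suc k * f (suc k)) + stir2 j k * f (suc k))
    ≡⟨ sumBelow-+ (suc j) (λ k → stir2 j (suc k) * (suc k * f (suc k))) (λ k → stir2 j k * f (suc k)) ⟩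
  combine j (stir2 j ∘ suc) (λ k → suc k * f (suc k)) + stir2Sum j (f ∘ suc)
    ≡⟨ cong (_+ stir2Sum j (f ∘ suc)) (sym weighted) ⟩
  stir2Sum j (λ k → k * f k) + stir2Sum j (f ∘ suc)
    ≡⟨ sym (combine-+ j (stir2 j) (λ k → k * f k) (f ∘ suc)) ⟩
  stir2Sum j (λ k → k * f k + f (suc k))  ∎
  where
  regroup : ∀ a b c d → (a * b + c) * d ≡ b * (a * d) + c * d
  regroup = solve-∀
  weighted : stir2Sum j (λ k → k * f k) ≡ combine j (stir2 j ∘ suc) (λ k → suc k * f (suc k))
  weighted = trans (combine-shift j (stir2 j) (λ k → k * f k) (stir2-vanish j (suc j) ≤-refl))
                   (cong (_+ combine j (stir2 j ∘ suc) (λ k → suc k * f (suc k))) (*-zeroʳ (stir2 j 0)))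

-- The operator describing one insertion step: a partition of [n] with k blocks has
-- n + k extensions with k blocks and one with k + 1 blocks.
grow : ℕ → (ℕ → ℕ) → ℕ → ℕ
grow n f k = (n + k) * f k + f (suc k)

stir2Sum-grow : ∀ n j (f : ℕ → ℕ) → stir2Sum j (grow n f) ≡ n * stir2Sum j f + stir2Sum (suc j) f
stir2Sum-grow n j f = begin
  stir2Sum j (grow n f)
    ≡⟨ combine-cong j (stir2 j) (λ k → split n k (f k) (f (suc k))) ⟩
  stir2Sum j (λ k → n * f k + (k * f k + f (suc k)))
    ≡⟨ combine-+ j (stir2 j) (λ k → n * f k) (λ k → k * f k + f (suc k)) ⟩
  stir2Sum j (λ k → n * f k) + stir2Sum j (λ k → k * f k + f (suc k))
    ≡⟨ cong₂ _+_ (combine-* j (stir2 j) n f) (sym (stir2Sum-suc j f)) ⟩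
  n * stir2Sum j f + stir2Sum (suc j) f  ∎
  where split : ∀ n k a b → (n + k) * a + b ≡ n * a + (k * a + b)
        split = solve-∀

absorb : ∀ n a b x → n * a ≡ 0 → n * (a * b + x) ≡ n * x
absorb n a b x na≡0 = begin
  n * (a * b + x)      ≡⟨ *-distribˡ-+ n (a * b) x ⟩
  n * (a * b) + n * x  ≡⟨ cong (_+ n * x) (trans (sym (*-assoc n a b)) (cong (_* b) na≡0)) ⟩
  n * x                ∎

stir1Sum-suc : ∀ n (h : ℕ → ℕ) → stir1Sum (suc n) h ≡ n * stir1Sum n h + stir1Sum n (h ∘ suc)
stir1Sum-suc n h = begin
  sumBelow (suc n) (λ j → (n * stir1 n (suc j) + stir1 n j) * h (suc j))
    ≡⟨ sumBelow-cong (suc n) (λ j → regroup n (stir1 n (suc j)) (stir1 n j) (h (suc j))) ⟩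
  sumBelow (suc n) (λ j → n * (stir1 n (suc j) * h (suc j)) + stir1 n j * h (suc j))
    ≡⟨ sumBelow-+ (suc n) (λ j → n * (stir1 n (suc j) * h (suc j))) (λ j → stir1 n j * h (suc j)) ⟩
  sumBelow (suc n) (λ j → n * (stir1 n (suc j) * h (suc j))) + stir1Sum n (h ∘ suc)
    ≡⟨ cong (_+ stir1Sum n (h ∘ suc)) (sumBelow-* (suc n) n (λ j → stir1 n (suc j) * h (suc j))) ⟩
  n * combine n (stir1 n ∘ suc) (h ∘ suc) + stir1Sum n (h ∘ suc)
    ≡⟨ cong (_+ stir1Sum n (h ∘ suc)) (sym shifted) ⟩
  n * stir1Sum n h + stir1Sum n (h ∘ suc)  ∎
  where
  regroup : ∀ a b c d → (a * b + c) * d ≡ a * (b * d) + c * d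
  regroup = solve-∀
  shifted : n * stir1Sum n h ≡ n * combine n (stir1 n ∘ suc) (h ∘ suc)
  shifted = trans (cong (n *_) (combine-shift n (stir1 n) h (stir1-vanish n (suc n) ≤-refl)))
                  (absorb n (stir1 n 0) (h 0) _ (stir1-zero n))

-- Replacing n - j by (n - (j+1)) + 1 in front of [n, j+1]; for j ≥ n both sides
-- vanish because [n, j+1] = 0.
defect-shift : ∀ n j → suc (n ∸ suc j) * stir1 n (suc j) ≡ (n ∸ j) * stir1 n (suc j)
defect-shift n j with j <? n
... | yes j<n = cong (_* stir1 n (suc j)) (sym (+-∸-assoc 1 j<n))
... | no  j≮n = begin
  suc (n ∸ suc j) * stir1 n (suc j)  ≡⟨ cong (suc (n ∸ suc j) *_) vanish ⟩
  suc (n ∸ suc j) * 0                ≡⟨ *-zeroʳ (suc (n ∸ suc j)) ⟩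
  0                                  ≡⟨ sym (*-zeroʳ (n ∸ j)) ⟩
  (n ∸ j) * 0                        ≡⟨ cong ((n ∸ j) *_) (sym vanish) ⟩
  (n ∸ j) * stir1 n (suc j)          ∎
  where vanish : stir1 n (suc j) ≡ 0
        vanish = stir1-vanish n (suc j) (s≤s (≮⇒≥ j≮n))

-- Σ_j (n - j)[n j] h j + Σ_j [n j] h j = Σ_j (n + 1 - j)[n j] h j, re-indexed from
-- j = 1: the term j = 0 dies under the factor n since [n 0] = 0 for n ≥ 1.
defect+stir1-shift : ∀ n (h : ℕ → ℕ) →
  n * (defectSum n h + stir1Sum n h) ≡ n * combine n (λ j → (n ∸ j) * stir1 n (suc j)) (h ∘ suc)
defect+stir1-shift n h = begin
  n * (defectSum n h + stir1Sum n h)                ≡⟨ cong (n *_) merged ⟩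
  n * combine n c h                                 ≡⟨ cong (n *_) (combine-shift n c h c[n+1]≡0) ⟩
  n * (c 0 * h 0 + combine n (c ∘ suc) (h ∘ suc))  ≡⟨ absorb n (c 0) (h 0) _ n*c0≡0 ⟩
  n * combine n (c ∘ suc) (h ∘ suc)                 ≡⟨ cong (n *_) (sumBelow-cong (suc n) (λ j → cong (_* h (suc j)) (defect-shift n j))) ⟩
  n * combine n (λ j → (n ∸ j) * stir1 n (suc j)) (h ∘ suc)  ∎
  where
  c : ℕ → ℕ
  c j = suc (n ∸ j) * stir1 n j
  merged : defectSum n h + stir1Sum n h ≡ combine n c h
  merged = sym (trans (sumBelow-cong (suc n) (λ j → d*s*x+s*x (n ∸ j) (stir1 n j) (h j)))
                      (sumBelow-+ (suc n) (λ j → (n ∸ j) * stir1 n j * h j) (λ j → stir1 n j * h j)))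
    where d*s*x+s*x : ∀ d s x → suc d * s * x ≡ d * s * x + s * x
          d*s*x+s*x = solve-∀
  c[n+1]≡0 : c (suc n) ≡ 0
  c[n+1]≡0 = trans (cong (suc (n ∸ suc n) *_) (stir1-vanish n (suc n) ≤-refl)) (*-zeroʳ (suc (n ∸ suc n)))
  n*c0≡0 : n * c 0 ≡ 0
  n*c0≡0 = trans (x*[a*y]≡a*[x*y] n (suc n) (stir1 n 0)) (trans (cong (suc n *_) (stir1-zero n)) (*-zeroʳ (suc n)))

defectSum-suc : ∀ n (h : ℕ → ℕ) →
  defectSum (suc n) h ≡ n * (defectSum n h + stir1Sum n h) + defectSum n (h ∘ suc)
defectSum-suc n h = begin
  suc n * 0 * h 0 + rest
    ≡⟨ cong (λ x → x * h 0 + rest) (*-zeroʳ (suc n)) ⟩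
  rest
    ≡⟨ sumBelow-cong (suc n) (λ j → regroup n (n ∸ j) (stir1 n (suc j)) (stir1 n j) (h (suc j))) ⟩
  sumBelow (suc n) (λ j → n * ((n ∸ j) * stir1 n (suc j) * h (suc j)) + (n ∸ j) * stir1 n j * h (suc j))
    ≡⟨ sumBelow-+ (suc n) (λ j → n * ((n ∸ j) * stir1 n (suc j) * h (suc j))) (λ j → (n ∸ j) * stir1 n j * h (suc j)) ⟩
  sumBelow (suc n) (λ j → n * ((n ∸ j) * stir1 n (suc j) * h (suc j))) + defectSum n (h ∘ suc)
    ≡⟨ cong (_+ defectSum n (h ∘ suc)) (sumBelow-* (suc n) n (λ j → (n ∸ j) * stir1 n (suc j) * h (suc j))) ⟩
  n * combine n (λ j → (n ∸ j) * stir1 n (suc j)) (h ∘ suc) + defectSum n (h ∘ suc)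
    ≡⟨ cong (_+ defectSum n (h ∘ suc)) (sym (defect+stir1-shift n h)) ⟩
  n * (defectSum n h + stir1Sum n h) + defectSum n (h ∘ suc)  ∎
  where
  rest : ℕ
  rest = sumBelow (suc n) (λ j → (n ∸ j) * (n * stir1 n (suc j) + stir1 n j) * h (suc j))
  regroup : ∀ n d a b e → d * (n * a + b) * e ≡ n * (d * a * e) + d * b * e
  regroup = solve-∀

combine-grow : ∀ n c m (f : ℕ → ℕ) →
  combine n c (λ j → stir2Sum j (grow m f)) ≡
  m * combine n c (λ j → stir2Sum j f) + combine n c (λ j → stir2Sum (suc j) f)
combine-grow n c m f = begin
  combine n c (λ j → stir2Sum j (grow m f))
    ≡⟨ combine-cong n c (λ j → stir2Sum-grow m j f) ⟩
  combine n c (λ j → m * stir2Sum j f + stir2Sum (suc j) f)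
    ≡⟨ combine-+ n c (λ j → m * stir2Sum j f) (λ j → stir2Sum (suc j) f) ⟩
  combine n c (λ j → m * stir2Sum j f) + combine n c (λ j → stir2Sum (suc j) f)
    ≡⟨ cong (_+ combine n c (λ j → stir2Sum (suc j) f)) (combine-* n c m (λ j → stir2Sum j f)) ⟩
  m * combine n c (λ j → stir2Sum j f) + combine n c (λ j → stir2Sum (suc j) f)  ∎

-- The identities A_{n+1}(f) = A_n(grow n f) and B_{n+1}(f) = B_n(grow n f) + n A_n(f)
-- are solved by A_n(f) = G_n(j ↦ P_j f) and B_n(f) = H_n(j ↦ P_j f).
stir1Sum-grow : ∀ n (f : ℕ → ℕ) →
  stir1Sum n (λ j → stir2Sum j (grow n f)) ≡ stir1Sum (suc n) (λ j → stir2Sum j f)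
stir1Sum-grow n f = trans (combine-grow n (stir1 n) n f) (sym (stir1Sum-suc n (λ j → stir2Sum j f)))

defectSum-grow : ∀ n (f : ℕ → ℕ) →
  defectSum n (λ j → stir2Sum j (grow n f)) + n * stir1Sum n (λ j → stir2Sum j f) ≡
  defectSum (suc n) (λ j → stir2Sum j f)
defectSum-grow n f = begin
  defectSum n (λ j → stir2Sum j (grow n f)) + n * G
    ≡⟨ cong (_+ n * G) (combine-grow n (λ j → (n ∸ j) * stir1 n j) n f) ⟩
  n * H + H′ + n * G
    ≡⟨ regroup n H H′ G ⟩
  n * (H + G) + H′
    ≡⟨ sym (defectSum-suc n (λ j → stir2Sum j f)) ⟩
  defectSum (suc n) (λ j → stir2Sum j f)  ∎
  where
  G H H′ : ℕ
  G  = stir1Sum n (λ j → stir2Sum j f)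
  H  = defectSum n (λ j → stir2Sum j f)
  H′ = defectSum n (λ j → stir2Sum (suc j) f)
  regroup : ∀ n h h′ g → n * h + h′ + n * g ≡ n * (h + g) + h′
  regroup = solve-∀

one : ℕ → ℕ
one _ = 1

bell≡stir2Sum : ∀ k → bell k ≡ stir2Sum k one
bell≡stir2Sum k = trans (sum-upTo (suc k) (stir2 k)) (sumBelow-cong (suc k) (λ j → sym (*-identityʳ (stir2 k j))))

denom≡stir1Sum : ∀ n → denom n ≡ stir1Sum n (λ k → stir2Sum k one)
denom≡stir1Sum n = trans (sum-upTo (suc n) (λ k → stir1 n k * bell k))
                         (combine-cong n (stir1 n) bell≡stir2Sum)

-- numer n = Σ_{j<n} j [n, n-j] B_{n-j}; the missing term j = n vanishes, and
-- reversing j ↦ n - j turns it into H_n(B).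
numer≡defectSum : ∀ n → numer n ≡ defectSum n (λ k → stir2Sum k one)
numer≡defectSum n = begin
  numer n                              ≡⟨ sum-upTo n F ⟩
  sumBelow n F                         ≡⟨ sym (sumBelow-dropLast n F Fn≡0) ⟩
  sumBelow (suc n) F                   ≡⟨ sumBelow-reverse (suc n) F ⟩
  sumBelow (suc n) (λ j → F (n ∸ j))
    ≡⟨ sumBelow-cong< (suc n) (λ j j≤n → cong (λ i → (n ∸ j) * stir1 n i * bell i) (m∸[m∸n]≡n (s≤s⁻¹ j≤n))) ⟩
  defectSum n bell                     ≡⟨ combine-cong n (λ j → (n ∸ j) * stir1 n j) bell≡stir2Sum ⟩
  defectSum n (λ k → stir2Sum k one)   ∎
  where
  F : ℕ → ℕ
  F j = j * stir1 n (n ∸ j) * bell (n ∸ j)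
  Fn≡0 : F n ≡ 0
  Fn≡0 = cong (_* bell (n ∸ n)) (trans (cong (λ i → n * stir1 n i) (n∸n≡0 n)) (stir1-zero n))

insEvery : ℕ → List ℕ → List (List ℕ)
insEvery m []       = [ [ m ] ]
insEvery m (y ∷ ys) = (m ∷ y ∷ ys) ∷ map (y ∷_) (insEvery m ys)

insTail : ℕ → Block → List Block
insTail m []       = []
insTail m (x ∷ xs) = map (x ∷_) (insEvery m xs)

-- In front of a block b,
-- m becomes the largest head, so m ∷ b moves to the end of the head order; anywhere
-- else the block keeps its head and its position.
insAll : ℕ → SL → List SL
insAll m []      = []
insAll m (b ∷ π) = (π ++ [ m ∷ b ]) ∷ (map (_∷ π) (insTail m b) ++ map (b ∷_) (insAll m π))

extensions : ℕ → SL → List SL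
extensions m π = (π ++ [ [ m ] ]) ∷ insAll m π

slp : ℕ → List SL
slp zero    = [ [] ]
slp (suc n) = concatMap (extensions (suc n)) (slp n)

data InsertedAt (m : ℕ) : List ℕ → List ℕ → Set where
  at : ∀ us vs → InsertedAt m (us ++ vs) (us ++ m ∷ vs)

data InsertedAfterHead (m : ℕ) : Block → Block → Set where
  afterHead : ∀ x us vs → InsertedAfterHead m (x ∷ us ++ vs) (x ∷ us ++ m ∷ vs)

data BlockInsertion (m : ℕ) : SL → SL → Set where
  front : ∀ pre b post → BlockInsertion m (pre ++ b ∷ post) ((pre ++ post) ++ [ m ∷ b ])
  inner : ∀ pre x us vs post →
    BlockInsertion m (pre ++ (x ∷ us ++ vs) ∷ post) (pre ++ (x ∷ us ++ m ∷ vs) ∷ post)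

insEvery⁻ : ∀ {m} xs {w} → w ∈ insEvery m xs → InsertedAt m xs w
insEvery⁻ []       (here refl) = at [] []
insEvery⁻ (y ∷ ys) (here refl) = at [] (y ∷ ys)
insEvery⁻ (y ∷ ys) (there w∈) with ∈-map⁻ (y ∷_) w∈
... | w′ , w′∈ , refl with insEvery⁻ ys w′∈
...   | at us vs = at (y ∷ us) vs

insEvery⁺ : ∀ m us vs → us ++ m ∷ vs ∈ insEvery m (us ++ vs)
insEvery⁺ m []       []       = here refl
insEvery⁺ m []       (v ∷ vs) = here refl
insEvery⁺ m (u ∷ us) vs       = there (∈-map⁺ (u ∷_) (insEvery⁺ m us vs))

insTail⁻ : ∀ {m} b {b′} → b′ ∈ insTail m b → InsertedAfterHead m b b′
insTail⁻ (x ∷ xs) b′∈ with ∈-map⁻ (x ∷_) b′∈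
... | w , w∈ , refl with insEvery⁻ xs w∈
...   | at us vs = afterHead x us vs

insTail⁺ : ∀ m x us vs → x ∷ us ++ m ∷ vs ∈ insTail m (x ∷ us ++ vs)
insTail⁺ m x us vs = ∈-map⁺ (x ∷_) (insEvery⁺ m us vs)

insAll⁻ : ∀ {m} π {e} → e ∈ insAll m π → BlockInsertion m π e
insAll⁻ (b ∷ π) (here refl) = front [] b π
insAll⁻ (b ∷ π) (there e∈) with ∈-++⁻ (map (_∷ π) (insTail _ b)) e∈
... | inj₁ e∈₁ with ∈-map⁻ (_∷ π) e∈₁
...   | b′ , b′∈ , refl with insTail⁻ b b′∈
...     | afterHead x us vs = inner [] x us vs π
insAll⁻ (b ∷ π) (there e∈) | inj₂ e∈₂ with ∈-map⁻ (b ∷_) e∈₂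
...   | e′ , e′∈ , refl with insAll⁻ π e′∈
...     | front pre b₀ post        = front (b ∷ pre) b₀ post
...     | inner pre x us vs post = inner (b ∷ pre) x us vs post

insAll⁺-front : ∀ m pre b post → (pre ++ post) ++ [ m ∷ b ] ∈ insAll m (pre ++ b ∷ post)
insAll⁺-front m []        b post = here refl
insAll⁺-front m (c ∷ pre) b post =
  there (∈-++⁺ʳ (map (_∷ (pre ++ b ∷ post)) (insTail m c)) (∈-map⁺ (c ∷_) (insAll⁺-front m pre b post)))

insAll⁺-inner : ∀ m pre x us vs post →
  pre ++ (x ∷ us ++ m ∷ vs) ∷ post ∈ insAll m (pre ++ (x ∷ us ++ vs) ∷ post)
insAll⁺-inner m []        x us vs post = there (∈-++⁺ˡ (∈-map⁺ (_∷ post) (insTail⁺ m x us vs)))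
insAll⁺-inner m (c ∷ pre) x us vs post =
  there (∈-++⁺ʳ (map (_∷ (pre ++ (x ∷ us ++ vs) ∷ post)) (insTail m c))
                (∈-map⁺ (c ∷_) (insAll⁺-inner m pre x us vs post)))

size : SL → ℕ
size π = length (concat π)

length-insEvery : ∀ m xs → length (insEvery m xs) ≡ suc (length xs)
length-insEvery m []       = refl
length-insEvery m (y ∷ ys) = cong suc (trans (length-map (y ∷_) (insEvery m ys)) (length-insEvery m ys))

length-insTail : ∀ m b → length (insTail m b) ≡ length b
length-insTail m []       = refl
length-insTail m (x ∷ xs) = trans (length-map (x ∷_) (insEvery m xs)) (length-insEvery m xs)

length-insAll : ∀ m π → length (insAll m π) ≡ size π + length π
length-insAll m []      = refl
length-insAll m (b ∷ π) = begin
  suc (length (map (_∷ π) (insTail m b) ++ map (b ∷_) (insAll m π)))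
    ≡⟨ cong suc (length-++ (map (_∷ π) (insTail m b))) ⟩
  suc (length (map (_∷ π) (insTail m b)) + length (map (b ∷_) (insAll m π)))
    ≡⟨ cong₂ (λ x y → suc (x + y)) (trans (length-map (_∷ π) (insTail m b)) (length-insTail m b))
                                   (trans (length-map (b ∷_) (insAll m π)) (length-insAll m π)) ⟩
  suc (length b + (size π + length π))
    ≡⟨ regroup (length b) (size π) (length π) ⟩
  (length b + size π) + suc (length π)
    ≡⟨ cong (_+ suc (length π)) (sym (length-++ b)) ⟩
  size (b ∷ π) + length (b ∷ π)  ∎
  where regroup : ∀ l s k → suc (l + (s + k)) ≡ (l + s) + suc k
        regroup = solve-∀

length-blockInsertion : ∀ {m π e} → BlockInsertion m π e → length e ≡ length π
length-blockInsertion {m} (front pre b post) = begin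
  length ((pre ++ post) ++ [ m ∷ b ])  ≡⟨ length-++ (pre ++ post) ⟩
  length (pre ++ post) + 1             ≡⟨ cong (_+ 1) (length-++ pre) ⟩
  length pre + length post + 1         ≡⟨ +-assoc (length pre) (length post) 1 ⟩
  length pre + (length post + 1)       ≡⟨ cong (length pre +_) (+-comm (length post) 1) ⟩
  length pre + suc (length post)       ≡⟨ sym (length-++ pre) ⟩
  length (pre ++ b ∷ post)             ∎
length-blockInsertion (inner pre x us vs post) = trans (length-++ pre) (sym (length-++ pre))

extensions-byBlocks : ∀ m π (f : ℕ → ℕ) →
  sum (map (λ e → f (length e)) (extensions m π)) ≡ grow (size π) f (length π)
extensions-byBlocks m π f = begin
  f (length (π ++ [ [ m ] ])) + sum (map (λ e → f (length e)) (insAll m π))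
    ≡⟨ cong₂ _+_ (cong f (trans (length-++ π) (+-comm (length π) 1)))
                 (sum-map-cong (insAll m π) (λ e e∈ → cong f (length-blockInsertion (insAll⁻ π e∈)))) ⟩
  f (suc (length π)) + sum (map (λ _ → f (length π)) (insAll m π))
    ≡⟨ cong (f (suc (length π)) +_) (sum-map-const (insAll m π) (f (length π))) ⟩
  f (suc (length π)) + length (insAll m π) * f (length π)
    ≡⟨ cong (λ x → f (suc (length π)) + x * f (length π)) (length-insAll m π) ⟩
  f (suc (length π)) + (size π + length π) * f (length π)
    ≡⟨ +-comm (f (suc (length π))) _ ⟩
  grow (size π) f (length π)  ∎

nse-++ : ∀ π σ → nse (π ++ σ) ≡ nse π + nse σ
nse-++ = sum-map-++ nseBlock

smallerRight : ℕ → List ℕ → ℕ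
smallerRight x xs = if any (λ y → y <ᵇ x) xs then 1 else 0

<ᵇ-true : ∀ {x m} → x < m → (x <ᵇ m) ≡ true
<ᵇ-true x<m = Equivalence.to T-≡ (<⇒<ᵇ x<m)

<ᵇ-false : ∀ {x m} → x < m → (m <ᵇ x) ≡ false
<ᵇ-false {x} {m} x<m with m <ᵇ x | <ᵇ⇒< m x
... | false | _   = refl
... | true  | m<x = ⊥-elim (<-asym x<m (m<x _))

smallerRight-insert : ∀ {x m} → x < m → ∀ us vs → smallerRight x (us ++ m ∷ vs) ≡ smallerRight x (us ++ vs)
smallerRight-insert {x} {m} x<m us vs = cong (λ b → if b then 1 else 0) (any-insert us)
  where any-insert : ∀ us → any (λ y → y <ᵇ x) (us ++ m ∷ vs) ≡ any (λ y → y <ᵇ x) (us ++ vs)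
        any-insert []       rewrite <ᵇ-false x<m = refl
        any-insert (u ∷ us) = cong ((u <ᵇ x) ∨_) (any-insert us)

nse-under-insEvery : ∀ {m} x xs → x < m →
  sum (map (λ w → nseBlock (x ∷ w)) (insEvery m xs)) ≡
  suc (length xs) * smallerRight x xs + sum (map nseBlock (insEvery m xs))
nse-under-insEvery {m} x xs x<m = begin
  sum (map (λ w → nseBlock (x ∷ w)) (insEvery m xs))
    ≡⟨ sum-map-cong (insEvery m xs) (λ w w∈ → cong (_+ nseBlock w) (unchanged w∈)) ⟩
  sum (map (λ w → smallerRight x xs + nseBlock w) (insEvery m xs))
    ≡⟨ sum-map-+const (insEvery m xs) (smallerRight x xs) nseBlock ⟩
  length (insEvery m xs) * smallerRight x xs + sum (map nseBlock (insEvery m xs))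
    ≡⟨ cong (λ l → l * smallerRight x xs + sum (map nseBlock (insEvery m xs))) (length-insEvery m xs) ⟩
  suc (length xs) * smallerRight x xs + sum (map nseBlock (insEvery m xs))  ∎
  where unchanged : ∀ {w} → w ∈ insEvery m xs → smallerRight x w ≡ smallerRight x xs
        unchanged w∈ with insEvery⁻ xs w∈
        ... | at us vs = smallerRight-insert x<m us vs

-- Inserting an entry m larger than all of xs: the old entries keep their status, and m
-- itself is out of place in the |xs| insertions that leave some entry to its right.
nse-insEvery : ∀ m xs → All (_< m) xs →
  sum (map nseBlock (insEvery m xs)) ≡ suc (length xs) * nseBlock xs + length xs
nse-insEvery m []       []          = refl
nse-insEvery m (y ∷ ys) (y<m ∷ ys<m) = begin
  nseBlock (m ∷ y ∷ ys) + sum (map nseBlock (map (y ∷_) (insEvery m ys)))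
    ≡⟨ cong₂ _+_ m-out-of-place (sum-map-∘ (insEvery m ys) (y ∷_) nseBlock) ⟩
  suc (nseBlock (y ∷ ys)) + sum (map (λ w → nseBlock (y ∷ w)) (insEvery m ys))
    ≡⟨ cong (suc (nseBlock (y ∷ ys)) +_) (nse-under-insEvery y ys y<m) ⟩
  suc (nseBlock (y ∷ ys)) + (suc (length ys) * s + sum (map nseBlock (insEvery m ys)))
    ≡⟨ cong (λ z → suc (nseBlock (y ∷ ys)) + (suc (length ys) * s + z)) (nse-insEvery m ys ys<m) ⟩
  suc (s + nseBlock ys) + (suc (length ys) * s + (suc (length ys) * nseBlock ys + length ys))
    ≡⟨ regroup (length ys) s (nseBlock ys) ⟩
  suc (suc (length ys)) * (s + nseBlock ys) + suc (length ys)  ∎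
  where
  s : ℕ
  s = smallerRight y ys
  m-out-of-place : nseBlock (m ∷ y ∷ ys) ≡ suc (nseBlock (y ∷ ys))
  m-out-of-place rewrite <ᵇ-true y<m = refl
  regroup : ∀ l i b → suc (i + b) + (suc l * i + (suc l * b + l)) ≡ suc (suc l) * (i + b) + suc l
  regroup = solve-∀

nse-insTail : ∀ m x xs → All (_< m) (x ∷ xs) →
  sum (map nseBlock (insTail m (x ∷ xs))) ≡ suc (length xs) * nseBlock (x ∷ xs) + length xs
nse-insTail m x xs (x<m ∷ xs<m) = begin
  sum (map nseBlock (map (x ∷_) (insEvery m xs)))
    ≡⟨ sum-map-∘ (insEvery m xs) (x ∷_) nseBlock ⟩
  sum (map (λ w → nseBlock (x ∷ w)) (insEvery m xs))
    ≡⟨ nse-under-insEvery x xs x<m ⟩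
  suc (length xs) * smallerRight x xs + sum (map nseBlock (insEvery m xs))
    ≡⟨ cong (suc (length xs) * smallerRight x xs +_) (nse-insEvery m xs xs<m) ⟩
  suc (length xs) * smallerRight x xs + (suc (length xs) * nseBlock xs + length xs)
    ≡⟨ regroup (length xs) (smallerRight x xs) (nseBlock xs) ⟩
  suc (length xs) * nseBlock (x ∷ xs) + length xs  ∎
  where regroup : ∀ l i b → suc l * i + (suc l * b + l) ≡ suc l * (i + b) + l
        regroup = solve-∀

nse-into-first : ∀ m x xs π → All (_< m) (x ∷ xs) →
  sum (map nse (map (_∷ π) (insTail m (x ∷ xs)))) ≡
  suc (length xs) * nseBlock (x ∷ xs) + length xs + suc (length xs) * nse π
nse-into-first m x xs π b<m = begin
  sum (map nse (map (_∷ π) (insTail m b)))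
    ≡⟨ sum-map-∘ (insTail m b) (_∷ π) nse ⟩
  sum (map (λ b′ → nseBlock b′ + nse π) (insTail m b))
    ≡⟨ sum-map-+ (insTail m b) nseBlock (λ _ → nse π) ⟩
  sum (map nseBlock (insTail m b)) + sum (map (λ _ → nse π) (insTail m b))
    ≡⟨ cong₂ _+_ (nse-insTail m x xs b<m) (sum-map-const (insTail m b) (nse π)) ⟩
  suc (length xs) * nseBlock b + length xs + length (insTail m b) * nse π
    ≡⟨ cong (λ l → suc (length xs) * nseBlock b + length xs + l * nse π) (length-insTail m b) ⟩
  suc (length xs) * nseBlock b + length xs + suc (length xs) * nse π  ∎
  where b : Block
        b = x ∷ xs

-- Inserting a new maximum m into the blocks of π (nonempty, entries below m): over the
-- size π + length π results, old entries keep their status and m is out of place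
-- exactly size π times (once per entry it can precede).
nse-insAll : ∀ m π → All NonEmpty π → All (_< m) (concat π) →
  sum (map nse (insAll m π)) ≡ (size π + length π) * nse π + size π
nse-insAll m []              []                     _      = refl
nse-insAll m ((x ∷ xs) ∷ π) (nonEmpty x xs ∷ π-ne) entries<m = begin
  nse (π ++ [ m ∷ b ]) + sum (map nse (map (_∷ π) (insTail m b) ++ map (b ∷_) (insAll m π)))
    ≡⟨ cong₂ _+_ moved-block (sum-map-++ nse (map (_∷ π) (insTail m b)) (map (b ∷_) (insAll m π))) ⟩
  (nse π + suc (nseBlock b)) + (sum (map nse (map (_∷ π) (insTail m b))) + sum (map nse (map (b ∷_) (insAll m π))))
    ≡⟨ cong₂ (λ u v → (nse π + suc (nseBlock b)) + (u + v)) (nse-into-first m x xs π b<m) into-π ⟩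
  (nse π + suc (nseBlock b)) + ((suc ℓ * nseBlock b + ℓ + suc ℓ * nse π) + ((s + k) * nseBlock b + ((s + k) * nse π + s)))
    ≡⟨ regroup ℓ s k (nse π) (nseBlock b) ⟩
  (suc (ℓ + s) + suc k) * (nseBlock b + nse π) + suc (ℓ + s)
    ≡⟨ cong (λ z → (suc z + suc k) * (nseBlock b + nse π) + suc z) (sym (length-++ xs)) ⟩
  (size (b ∷ π) + length (b ∷ π)) * nse (b ∷ π) + size (b ∷ π)  ∎
  where
  b : Block
  b = x ∷ xs
  ℓ s k : ℕ
  ℓ = length xs
  s = size π
  k = length π
  b<m : All (_< m) b
  b<m = AllP.++⁻ˡ b entries<m
  π<m : All (_< m) (concat π)
  π<m = AllP.++⁻ʳ b entries<m
  moved-block : nse (π ++ [ m ∷ b ]) ≡ nse π + suc (nseBlock b)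
  moved-block rewrite nse-++ π [ m ∷ b ] | <ᵇ-true (All.head b<m) = cong (λ z → nse π + suc z) (+-identityʳ (nseBlock b))
  into-π : sum (map nse (map (b ∷_) (insAll m π))) ≡ (s + k) * nseBlock b + ((s + k) * nse π + s)
  into-π = begin
    sum (map nse (map (b ∷_) (insAll m π)))                      ≡⟨ sum-map-∘ (insAll m π) (b ∷_) nse ⟩
    sum (map (λ e → nseBlock b + nse e) (insAll m π))             ≡⟨ sum-map-+const (insAll m π) (nseBlock b) nse ⟩
    length (insAll m π) * nseBlock b + sum (map nse (insAll m π))
      ≡⟨ cong₂ (λ u v → u * nseBlock b + v) (length-insAll m π) (nse-insAll m π π-ne π<m) ⟩
    (s + k) * nseBlock b + ((s + k) * nse π + s)                  ∎
  regroup : ∀ l s k N nb → (N + suc nb) + ((suc l * nb + l + suc l * N) + ((s + k) * nb + ((s + k) * N + s))) ≡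
                           (suc (l + s) + suc k) * (nb + N) + suc (l + s)
  regroup = solve-∀

extensions-nse : ∀ m π (f : ℕ → ℕ) → All NonEmpty π → All (_< m) (concat π) →
  sum (map (λ e → nse e * f (length e)) (extensions m π)) ≡
  nse π * grow (size π) f (length π) + size π * f (length π)
extensions-nse m π f π-ne entries<m = begin
  nse (π ++ [ [ m ] ]) * f (length (π ++ [ [ m ] ])) + sum (map (λ e → nse e * f (length e)) (insAll m π))
    ≡⟨ cong₂ _+_ (cong₂ _*_ (trans (nse-++ π [ [ m ] ]) (+-identityʳ (nse π))) (cong f (trans (length-++ π) (+-comm (length π) 1))))
                 (sum-map-cong (insAll m π) (λ e e∈ → cong (λ z → nse e * f z) (length-blockInsertion (insAll⁻ π e∈)))) ⟩
  nse π * f (suc k) + sum (map (λ e → nse e * f k) (insAll m π))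
    ≡⟨ cong (nse π * f (suc k) +_) (sum-map-*ʳ (insAll m π) (f k) nse) ⟩
  nse π * f (suc k) + sum (map nse (insAll m π)) * f k
    ≡⟨ cong (λ z → nse π * f (suc k) + z * f k) (nse-insAll m π π-ne entries<m) ⟩
  nse π * f (suc k) + ((size π + k) * nse π + size π) * f k
    ≡⟨ regroup (size π) k (nse π) (f k) (f (suc k)) ⟩
  nse π * grow (size π) f k + size π * f k  ∎
  where
  k : ℕ
  k = length π
  regroup : ∀ s k N a b → N * b + ((s + k) * N + s) * a ≡ N * ((s + k) * a + b) + s * a
  regroup = solve-∀

range1-snoc : ∀ n → range1 (suc n) ≡ range1 n ++ [ suc n ]
range1-snoc n = trans (cong (map suc) (sym (upTo-∷ʳ n))) (map-++ suc (upTo n) [ n ])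

range1-< : ∀ n → All (_< suc n) (range1 n)
range1-< n = subst (All (_< suc n)) (sym (map-upTo suc n)) (AllP.applyUpTo⁺₁ suc n s≤s)

length-range1 : ∀ n → length (range1 n) ≡ n
length-range1 n = trans (length-map suc (upTo n)) (length-upTo n)

range1-unique : ∀ n → Unique (range1 n)
range1-unique n = Unique.map⁺ suc-injective (Unique.upTo⁺ n)

last∈range1 : ∀ n → suc n ∈ range1 (suc n)
last∈range1 n = subst (suc n ∈_) (sym (range1-snoc n)) (∈-++⁺ʳ (range1 n) (here refl))

Unique-resp-↭ : ∀ {xs ys : List A} → xs ↭ ys → Unique xs → Unique ys
Unique-resp-↭ {A = A} xs↭ys = PermSetoid.Unique-resp-↭ (setoid A) (↭⇒↭ₛ xs↭ys)

↭-cancel-∷ʳ : ∀ {xs ys : List A} m → xs ++ [ m ] ↭ ys ++ [ m ] → xs ↭ ys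
↭-cancel-∷ʳ {xs = xs} {ys} m p = drop-∷ (↭-trans (∷↭∷ʳ m xs) (↭-trans p (↭-sym (∷↭∷ʳ m ys))))

unique-disjoint : ∀ (xs : List A) {ys x} → Unique (xs ++ ys) → x ∈ xs → x ∈ ys → ⊥
unique-disjoint (a ∷ xs) (a∉ ∷ _)    (here refl) x∈ys = All.lookup a∉ (∈-++⁺ʳ xs x∈ys) refl
unique-disjoint (a ∷ xs) (_  ∷ uniq) (there x∈xs) x∈ys = unique-disjoint xs uniq x∈xs x∈ys

All-remove : ∀ {P : A → Set} xs {y ys} → All P (xs ++ y ∷ ys) → All P (xs ++ ys)
All-remove xs ps = AllP.++⁺ (AllP.++⁻ˡ xs ps) (All.tail (AllP.++⁻ʳ xs ps))

All-middle : ∀ {P : A → Set} xs {y ys} → All P (xs ++ y ∷ ys) → P y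
All-middle xs ps = All.head (AllP.++⁻ʳ xs ps)

All-insert : ∀ {P : A → Set} xs {y ys} → All P (xs ++ ys) → P y → All P (xs ++ y ∷ ys)
All-insert xs ps py = AllP.++⁺ (AllP.++⁻ˡ xs ps) (py ∷ AllP.++⁻ʳ xs ps)

All-replace : ∀ {P : A → Set} xs {y y′ ys} → All P (xs ++ y ∷ ys) → P y′ → All P (xs ++ y′ ∷ ys)
All-replace xs ps py′ = All-insert xs (All-remove xs ps) py′

AllPairs-remove : ∀ {R : A → A → Set} xs {y ys} → AllPairs R (xs ++ y ∷ ys) → AllPairs R (xs ++ ys)
AllPairs-remove []       (_ ∷ rs)  = rs
AllPairs-remove (x ∷ xs) (r ∷ rs) = All-remove xs r ∷ AllPairs-remove xs rs

AllPairs-snoc : ∀ {R : A → A → Set} {xs y} → AllPairs R xs → All (λ x → R x y) xs → AllPairs R (xs ++ [ y ])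
AllPairs-snoc rs r = AllPairs.++⁺ rs ([] ∷ []) (All.map (_∷ []) r)

AllPairs-prefix : ∀ {R : A → A → Set} xs {ys} → AllPairs R (xs ++ ys) → AllPairs R xs
AllPairs-prefix []       _        = []
AllPairs-prefix (x ∷ xs) (r ∷ rs) = AllP.++⁻ˡ xs r ∷ AllPairs-prefix xs rs

AllPairs-suffix : ∀ {R : A → A → Set} xs {ys} → AllPairs R (xs ++ ys) → AllPairs R ys
AllPairs-suffix []       rs       = rs
AllPairs-suffix (x ∷ xs) (_ ∷ rs) = AllPairs-suffix xs rs

first : Block → ℕ
first []      = 0
first (x ∷ _) = x

_≺_ : Block → Block → Set
b ≺ c = first b < first c

-- The canonical order of the blocks, in a form stable under deleting blocks.
Sorted : SL → Set
Sorted = AllPairs _≺_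

linked⇒sorted : ∀ {π} → Linked HeadLt π → Sorted π
linked⇒sorted l = Linked⇒AllPairs (λ {b c d} → <-trans {first b} {first c} {first d})
                                   (Linked.map (λ { (headLt x<y) → x<y }) l)

sorted⇒linked : ∀ {π} → All NonEmpty π → Sorted π → Linked HeadLt π
sorted⇒linked ne s = go ne (AllPairs⇒Linked s)
  where go : ∀ {π} → All NonEmpty π → Linked _≺_ π → Linked HeadLt π
        go []                                     []        = []
        go (_ ∷ [])                               [-]       = [-]
        go (nonEmpty x xs ∷ nonEmpty y ys ∷ ne) (x<y ∷ l) = headLt x<y ∷ go (nonEmpty y ys ∷ ne) l

Sorted-replace : ∀ pre {x xs ys post} → Sorted (pre ++ (x ∷ xs) ∷ post) → Sorted (pre ++ (x ∷ ys) ∷ post)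
Sorted-replace []        (r ∷ rs) = r ∷ rs
Sorted-replace (c ∷ pre) (r ∷ rs) = All-replace pre r (All-middle pre r) ∷ Sorted-replace pre rs

firsts-< : ∀ {k} π → All NonEmpty π → All (_< k) (concat π) → All (λ c → first c < k) π
firsts-< []              []                 _     = []
firsts-< ((x ∷ xs) ∷ π) (nonEmpty x xs ∷ ne) x<k = All.head x<k ∷ firsts-< π ne (AllP.++⁻ʳ (x ∷ xs) x<k)

concat-middle : ∀ pre (c : Block) post → concat (pre ++ c ∷ post) ≡ concat pre ++ c ++ concat post
concat-middle pre c post = sym (concat-++ pre (c ∷ post))

entries-singleton : ∀ (m : ℕ) (π : SL) → concat (π ++ [ [ m ] ]) ↭ concat π ++ [ m ]
entries-singleton m π = ↭-reflexive (sym (concat-++ π [ [ m ] ]))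

entries-front : ∀ m pre b post →
  concat ((pre ++ post) ++ [ m ∷ b ]) ↭ concat (pre ++ b ∷ post) ++ [ m ]
entries-front m pre b post =
  ↭-trans (↭-reflexive reorder)
    (↭-trans (++⁺ˡ P (↭-trans (++-comm Q (m ∷ b)) (∷↭∷ʳ m (b ++ Q))))
             (↭-reflexive rejoin))
  where
  P Q : List ℕ
  P = concat pre
  Q = concat post
  reorder : concat ((pre ++ post) ++ [ m ∷ b ]) ≡ P ++ (Q ++ m ∷ b)
  reorder = trans (sym (concat-++ (pre ++ post) [ m ∷ b ]))
                  (trans (cong₂ _++_ (sym (concat-++ pre post)) (cong (m ∷_) (++-identityʳ b)))
                         (++-assoc P Q (m ∷ b)))
  rejoin : P ++ ((b ++ Q) ++ [ m ]) ≡ concat (pre ++ b ∷ post) ++ [ m ]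
  rejoin = trans (sym (++-assoc P (b ++ Q) [ m ])) (cong (_++ [ m ]) (sym (concat-middle pre b post)))

entries-inner : ∀ m pre x us vs post →
  concat (pre ++ (x ∷ us ++ m ∷ vs) ∷ post) ↭ concat (pre ++ (x ∷ us ++ vs) ∷ post) ++ [ m ]
entries-inner m pre x us vs post =
  ↭-trans (↭-reflexive split-at-m)
    (↭-trans (↭-trans (shift m (P ++ x ∷ us) (vs ++ Q)) (∷↭∷ʳ m ((P ++ x ∷ us) ++ (vs ++ Q))))
             (↭-reflexive (cong (_++ [ m ]) rejoin)))
  where
  P Q : List ℕ
  P = concat pre
  Q = concat post
  split-at-m : concat (pre ++ (x ∷ us ++ m ∷ vs) ∷ post) ≡ (P ++ x ∷ us) ++ m ∷ (vs ++ Q)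
  split-at-m = trans (concat-middle pre (x ∷ us ++ m ∷ vs) post)
                     (trans (cong (λ z → P ++ x ∷ z) (++-assoc us (m ∷ vs) Q))
                            (sym (++-assoc P (x ∷ us) (m ∷ (vs ++ Q)))))
  rejoin : (P ++ x ∷ us) ++ (vs ++ Q) ≡ concat (pre ++ (x ∷ us ++ vs) ∷ post)
  rejoin = trans (++-assoc P (x ∷ us) (vs ++ Q))
                 (trans (cong (λ z → P ++ x ∷ z) (sym (++-assoc us vs Q)))
                        (sym (concat-middle pre (x ∷ us ++ vs) post)))

entries-< : ∀ {n π} → IsSLP n π → All (_< suc n) (concat π)
entries-< {n} (_ , π↭[n] , _) = All-resp-↭ (↭-sym π↭[n]) (range1-< n)

size-SLP : ∀ {n π} → IsSLP n π → size π ≡ n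
size-SLP {n} (_ , π↭[n] , _) = trans (↭-length π↭[n]) (length-range1 n)

entries-unique : ∀ {n π} → IsSLP n π → Unique (concat π)
entries-unique {n} (_ , π↭[n] , _) = Unique-resp-↭ (↭-sym π↭[n]) (range1-unique n)

extend-entries : ∀ {n} e π → concat e ↭ concat π ++ [ suc n ] → concat π ↭ range1 n → concat e ↭ range1 (suc n)
extend-entries {n} e π e↭π+m π↭[n] = ↭-trans e↭π+m (↭-trans (++⁺ʳ [ suc n ] π↭[n]) (↭-reflexive (sym (range1-snoc n))))

restrict-entries : ∀ {n} e π → concat e ↭ concat π ++ [ suc n ] → concat e ↭ range1 (suc n) → concat π ↭ range1 n
restrict-entries {n} e π e↭π+m e↭[n+1] =
  ↭-cancel-∷ʳ (suc n) (↭-trans (↭-sym e↭π+m) (↭-trans e↭[n+1] (↭-reflexive (range1-snoc n))))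

extensions-valid : ∀ n π e → IsSLP n π → e ∈ extensions (suc n) π → IsSLP (suc n) e
extensions-valid n π _ valid@(π-ne , π↭[n] , π-linked) (here refl) =
  e-ne , extend-entries (π ++ [ [ suc n ] ]) π (entries-singleton (suc n) π) π↭[n] ,
  sorted⇒linked e-ne (AllPairs-snoc (linked⇒sorted π-linked) (firsts-< π π-ne (entries-< valid)))
  where e-ne : All NonEmpty (π ++ [ [ suc n ] ])
        e-ne = AllP.++⁺ π-ne (nonEmpty (suc n) [] ∷ [])
extensions-valid n π e valid@(π-ne , π↭[n] , π-linked) (there e∈) with insAll⁻ π e∈
... | front pre b post =
  e-ne , extend-entries ((pre ++ post) ++ [ suc n ∷ b ]) (pre ++ b ∷ post) (entries-front (suc n) pre b post) π↭[n] ,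
  sorted⇒linked e-ne (AllPairs-snoc (AllPairs-remove pre (linked⇒sorted π-linked))
                                    (All-remove pre (firsts-< π π-ne (entries-< valid))))
  where e-ne : All NonEmpty ((pre ++ post) ++ [ suc n ∷ b ])
        e-ne = AllP.++⁺ (All-remove pre π-ne) (nonEmpty (suc n) b ∷ [])
... | inner pre x us vs post =
  e-ne , extend-entries (pre ++ (x ∷ us ++ suc n ∷ vs) ∷ post) (pre ++ (x ∷ us ++ vs) ∷ post)
                      (entries-inner (suc n) pre x us vs post) π↭[n] ,
  sorted⇒linked e-ne (Sorted-replace pre (linked⇒sorted π-linked))
  where e-ne : All NonEmpty (pre ++ (x ∷ us ++ suc n ∷ vs) ∷ post)
        e-ne = All-replace pre π-ne (nonEmpty x (us ++ suc n ∷ vs))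

insertSorted : ∀ pre b → Sorted pre → All (λ c → first c ≢ first b) pre →
  ∃₂ λ p₁ p₂ → pre ≡ p₁ ++ p₂ × Sorted (p₁ ++ b ∷ p₂)
insertSorted []       b []       []      = [] , [] , refl , [] ∷ []
insertSorted (c ∷ cs) b (r ∷ rs) (c≢b ∷ cs≢b) with first b <? first c
... | yes b≺c = [] , c ∷ cs , refl , (b≺c ∷ All.map (<-trans b≺c) r) ∷ r ∷ rs
... | no  b⊀c with insertSorted cs b rs cs≢b
...   | p₁ , p₂ , refl , sorted = c ∷ p₁ , p₂ , refl , All-insert p₁ r (≤∧≢⇒< (≮⇒≥ b⊀c) c≢b) ∷ sorted

Restricts : ℕ → SL → Set
Restricts n e = ∃ λ π → IsSLP n π × e ∈ extensions (suc n) π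

restrict-inner : ∀ n pre y us vs post →
  IsSLP (suc n) (pre ++ (y ∷ us ++ suc n ∷ vs) ∷ post) → Restricts n (pre ++ (y ∷ us ++ suc n ∷ vs) ∷ post)
restrict-inner n pre y us vs post (e-ne , e↭[n+1] , e-linked) =
  pre ++ (y ∷ us ++ vs) ∷ post ,
  (π-ne , restrict-entries (pre ++ (y ∷ us ++ suc n ∷ vs) ∷ post) (pre ++ (y ∷ us ++ vs) ∷ post)
                           (entries-inner (suc n) pre y us vs post) e↭[n+1] ,
   sorted⇒linked π-ne (Sorted-replace pre (linked⇒sorted e-linked))) ,
  there (insAll⁺-inner (suc n) pre y us vs post)
  where π-ne : All NonEmpty (pre ++ (y ∷ us ++ vs) ∷ post)
        π-ne = All-replace pre e-ne (nonEmpty y (us ++ vs))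

-- n + 1 forms a singleton block, necessarily the last one: delete that block.
restrict-singleton : ∀ n pre → IsSLP (suc n) (pre ++ [ [ suc n ] ]) → Restricts n (pre ++ [ [ suc n ] ])
restrict-singleton n pre (e-ne , e↭[n+1] , e-linked) =
  pre ,
  (π-ne , restrict-entries (pre ++ [ [ suc n ] ]) pre (entries-singleton (suc n) pre) e↭[n+1] ,
   sorted⇒linked π-ne (AllPairs-prefix pre (linked⇒sorted e-linked))) ,
  here refl
  where π-ne : All NonEmpty pre
        π-ne = AllP.++⁻ˡ pre e-ne

firsts-∉ : ∀ pre {rest z} → All NonEmpty pre → Unique (concat pre ++ rest) → z ∈ rest →
  All (λ c → first c ≢ z) pre
firsts-∉ pre {rest} {z} pre-ne uniq z∈rest = All.tabulate (λ {c} c∈pre → first≢ c c∈pre (All.lookup pre-ne c∈pre))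
  where first≢ : ∀ c → c ∈ pre → NonEmpty c → first c ≢ z
        first≢ (w ∷ ws) c∈pre (nonEmpty w ws) refl =
          unique-disjoint (concat pre) uniq (∈-concat⁺′ (here refl) c∈pre) z∈rest

-- n + 1 heads the last block (n + 1) ∷ z ∷ zs: remove it and put z ∷ zs back into its
-- place in the head order; z is not the first entry of another block as entries are distinct.
restrict-front : ∀ n pre z zs → IsSLP (suc n) (pre ++ [ suc n ∷ z ∷ zs ]) →
  Restricts n (pre ++ [ suc n ∷ z ∷ zs ])
restrict-front n pre z zs valid@(e-ne , e↭[n+1] , e-linked)
  with e-unique ← subst Unique (concat-middle pre (suc n ∷ z ∷ zs) []) (entries-unique valid)
  with insertSorted pre (z ∷ zs) (AllPairs-prefix pre (linked⇒sorted e-linked))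
                    (firsts-∉ pre (AllP.++⁻ˡ pre e-ne) e-unique (there (here refl)))
... | p₁ , p₂ , refl , sorted =
  p₁ ++ (z ∷ zs) ∷ p₂ ,
  (π-ne , restrict-entries ((p₁ ++ p₂) ++ [ suc n ∷ z ∷ zs ]) (p₁ ++ (z ∷ zs) ∷ p₂)
                           (entries-front (suc n) p₁ (z ∷ zs) p₂) e↭[n+1] ,
   sorted⇒linked π-ne sorted) ,
  there (insAll⁺-front (suc n) p₁ (z ∷ zs) p₂)
  where
  π-ne : All NonEmpty (p₁ ++ (z ∷ zs) ∷ p₂)
  π-ne = All-insert p₁ (AllP.++⁻ˡ (p₁ ++ p₂) e-ne) (nonEmpty z zs)

-- n + 1 heads a block; that block has the largest first entry, so it is the last one.
restrict-headed : ∀ n pre ys post → IsSLP (suc n) (pre ++ (suc n ∷ ys) ∷ post) →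
  Restricts n (pre ++ (suc n ∷ ys) ∷ post)
restrict-headed n pre []       []       valid = restrict-singleton n pre valid
restrict-headed n pre (z ∷ zs) []       valid = restrict-front n pre z zs valid
restrict-headed n pre ys       (c ∷ cs) valid@(e-ne , _ , e-linked)
  with AllPairs-suffix pre (linked⇒sorted e-linked)
     | AllP.++⁻ʳ pre (firsts-< (pre ++ (suc n ∷ ys) ∷ c ∷ cs) e-ne (entries-< valid))
... | (n+1≺c ∷ _) ∷ _ | _ ∷ c≤n+1 ∷ _ = ⊥-elim (<-irrefl refl (<-≤-trans n+1≺c (s≤s⁻¹ c≤n+1)))

-- Every e ∈ SLP_{n+1} is an extension of some π ∈ SLP_n: locate the block containing n + 1.
restriction : ∀ n e → IsSLP (suc n) e → Restricts n e
restriction n e valid@(_ , e↭[n+1] , _)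
  with blk , n+1∈blk , blk∈e ← ∈-concat⁻′ e (∈-resp-↭ (↭-sym e↭[n+1]) (last∈range1 n))
  with pre , post , refl ← ∈-∃++ blk∈e
  with n+1∈blk
... | here refl   = restrict-headed n pre _ post valid
... | there n+1∈ys with us , vs , refl ← ∈-∃++ n+1∈ys = restrict-inner n pre _ us vs post valid

-- Undoing an extension: delete m from its block, drop the block if it became empty,
-- and otherwise move the last block (the one m was heading, if any) back into the head order.
remove : ℕ → Block → Block
remove m []       = []
remove m (x ∷ xs) with x ≟ m
... | yes _ = xs
... | no  _ = x ∷ remove m xs

lastBlock : SL → Block
lastBlock []          = []
lastBlock (b ∷ [])    = b
lastBlock (b ∷ c ∷ π) = lastBlock (c ∷ π)

initBlocks : SL → SL
initBlocks []          = []
initBlocks (b ∷ [])    = []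
initBlocks (b ∷ c ∷ π) = b ∷ initBlocks (c ∷ π)

insertByFirst : Block → SL → SL
insertByFirst b []      = [ b ]
insertByFirst b (c ∷ π) = if first c <ᵇ first b then c ∷ insertByFirst b π else b ∷ c ∷ π

settleLast : SL → SL
settleLast π = if null (lastBlock π) then initBlocks π else insertByFirst (lastBlock π) (initBlocks π)

unextend : ℕ → SL → SL
unextend m e = settleLast (map (remove m) e)

lastBlock-snoc : ∀ π b → lastBlock (π ++ [ b ]) ≡ b
lastBlock-snoc []          b = refl
lastBlock-snoc (c ∷ [])    b = refl
lastBlock-snoc (c ∷ d ∷ π) b = lastBlock-snoc (d ∷ π) b

initBlocks-snoc : ∀ π b → initBlocks (π ++ [ b ]) ≡ π
initBlocks-snoc []          b = refl
initBlocks-snoc (c ∷ [])    b = refl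
initBlocks-snoc (c ∷ d ∷ π) b = cong (c ∷_) (initBlocks-snoc (d ∷ π) b)

settleLast-empty : ∀ π → settleLast (π ++ [ [] ]) ≡ π
settleLast-empty π rewrite lastBlock-snoc π [] = initBlocks-snoc π []

settleLast-nonempty : ∀ π y ys → settleLast (π ++ [ y ∷ ys ]) ≡ insertByFirst (y ∷ ys) π
settleLast-nonempty π y ys rewrite lastBlock-snoc π (y ∷ ys) = cong (insertByFirst (y ∷ ys)) (initBlocks-snoc π (y ∷ ys))

insertByFirst-sorted : ∀ p₁ {b p₂} → Sorted (p₁ ++ b ∷ p₂) → insertByFirst b (p₁ ++ p₂) ≡ p₁ ++ b ∷ p₂
insertByFirst-sorted []        {b} {[]}     _               = refl
insertByFirst-sorted []        {b} {c ∷ p₂} ((b≺c ∷ _) ∷ _) rewrite <ᵇ-false b≺c = refl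
insertByFirst-sorted (c ∷ p₁) (c≺ ∷ sorted) rewrite <ᵇ-true (All-middle p₁ c≺) = cong (c ∷_) (insertByFirst-sorted p₁ sorted)

snoc-form : ∀ (c : A) rest → ∃₂ λ ys y → c ∷ rest ≡ ys ++ [ y ]
snoc-form c []       = [] , c , refl
snoc-form c (d ∷ rest) with ys , y , eq ← snoc-form d rest = c ∷ ys , y , cong (c ∷_) eq

settleLast-sorted : ∀ π → All NonEmpty π → Sorted π → settleLast π ≡ π
settleLast-sorted []       _  _      = refl
settleLast-sorted (c ∷ rest) ne sorted with snoc-form c rest
... | ys , []     , eq = ⊥-elim (empty-block (All-middle ys (subst (All NonEmpty) eq ne)))
  where empty-block : NonEmpty [] → ⊥
        empty-block ()
... | ys , y ∷ zs , eq rewrite eq = begin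
  settleLast (ys ++ [ y ∷ zs ])      ≡⟨ settleLast-nonempty ys y zs ⟩
  insertByFirst (y ∷ zs) ys          ≡⟨ cong (insertByFirst (y ∷ zs)) (sym (++-identityʳ ys)) ⟩
  insertByFirst (y ∷ zs) (ys ++ [])  ≡⟨ insertByFirst-sorted ys sorted ⟩
  ys ++ [ y ∷ zs ]                   ∎

remove-absent : ∀ {m} b → All (_< m) b → remove m b ≡ b
remove-absent []       []          = refl
remove-absent {m} (x ∷ xs) (x<m ∷ xs<m) with x ≟ m
... | yes refl = ⊥-elim (<-irrefl refl x<m)
... | no  _    = cong (x ∷_) (remove-absent xs xs<m)

remove-after : ∀ {m} us vs → All (_< m) us → remove m (us ++ m ∷ vs) ≡ us ++ vs
remove-after {m} []       vs []            with m ≟ m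
... | yes _   = refl
... | no  m≢m = ⊥-elim (m≢m refl)
remove-after {m} (u ∷ us) vs (u<m ∷ us<m) with u ≟ m
... | yes refl = ⊥-elim (<-irrefl refl u<m)
... | no  _    = cong (u ∷_) (remove-after us vs us<m)

map-remove-absent : ∀ {m} π → All (All (_< m)) π → map (remove m) π ≡ π
map-remove-absent []      []          = refl
map-remove-absent (b ∷ π) (b<m ∷ π<m) = cong₂ _∷_ (remove-absent b b<m) (map-remove-absent π π<m)

unextend-singleton : ∀ m π → All (All (_< m)) π → unextend m (π ++ [ [ m ] ]) ≡ π
unextend-singleton m π π<m = begin
  settleLast (map (remove m) (π ++ [ [ m ] ]))        ≡⟨ cong settleLast (map-++ (remove m) π [ [ m ] ]) ⟩
  settleLast (map (remove m) π ++ [ remove m [ m ] ])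
    ≡⟨ cong₂ (λ σ b → settleLast (σ ++ [ b ])) (map-remove-absent π π<m) (remove-after [] [] []) ⟩
  settleLast (π ++ [ [] ])                            ≡⟨ settleLast-empty π ⟩
  π                                                   ∎

unextend-front : ∀ m pre b post → All (All (_< m)) (pre ++ b ∷ post) → NonEmpty b → Sorted (pre ++ b ∷ post) →
  unextend m ((pre ++ post) ++ [ m ∷ b ]) ≡ pre ++ b ∷ post
unextend-front m pre (x ∷ xs) post π<m (nonEmpty x xs) sorted = begin
  settleLast (map (remove m) ((pre ++ post) ++ [ m ∷ x ∷ xs ]))
    ≡⟨ cong settleLast (map-++ (remove m) (pre ++ post) [ m ∷ x ∷ xs ]) ⟩
  settleLast (map (remove m) (pre ++ post) ++ [ remove m (m ∷ x ∷ xs) ])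
    ≡⟨ cong₂ (λ σ b → settleLast (σ ++ [ b ])) (map-remove-absent (pre ++ post) (All-remove pre π<m)) (remove-after [] (x ∷ xs) []) ⟩
  settleLast ((pre ++ post) ++ [ x ∷ xs ])
    ≡⟨ settleLast-nonempty (pre ++ post) x xs ⟩
  insertByFirst (x ∷ xs) (pre ++ post)
    ≡⟨ insertByFirst-sorted pre sorted ⟩
  pre ++ (x ∷ xs) ∷ post  ∎

unextend-inner : ∀ m pre x us vs post → let π = pre ++ (x ∷ us ++ vs) ∷ post in
  All (All (_< m)) π → All NonEmpty π → Sorted π →
  unextend m (pre ++ (x ∷ us ++ m ∷ vs) ∷ post) ≡ π
unextend-inner m pre x us vs post π<m ne sorted = begin
  settleLast (map (remove m) (pre ++ (x ∷ us ++ m ∷ vs) ∷ post))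
    ≡⟨ cong settleLast (map-++ (remove m) pre ((x ∷ us ++ m ∷ vs) ∷ post)) ⟩
  settleLast (map (remove m) pre ++ remove m (x ∷ us ++ m ∷ vs) ∷ map (remove m) post)
    ≡⟨ cong₂ (λ σ b → settleLast (σ ++ b ∷ map (remove m) post)) (map-remove-absent pre (AllP.++⁻ˡ pre π<m))
             (remove-after (x ∷ us) vs (AllP.++⁻ˡ (x ∷ us) (All-middle pre π<m))) ⟩
  settleLast (pre ++ (x ∷ us ++ vs) ∷ map (remove m) post)
    ≡⟨ cong (λ τ → settleLast (pre ++ (x ∷ us ++ vs) ∷ τ)) (map-remove-absent post (All.tail (AllP.++⁻ʳ pre π<m))) ⟩
  settleLast (pre ++ (x ∷ us ++ vs) ∷ post)
    ≡⟨ settleLast-sorted (pre ++ (x ∷ us ++ vs) ∷ post) ne sorted ⟩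
  pre ++ (x ∷ us ++ vs) ∷ post  ∎

unextend-extensions : ∀ n π e → IsSLP n π → e ∈ extensions (suc n) π → unextend (suc n) e ≡ π
unextend-extensions n π _ valid (here refl) = unextend-singleton (suc n) π (AllP.concat⁻ (entries-< valid))
unextend-extensions n π e valid@(ne , _ , linked) (there e∈) with insAll⁻ π e∈
... | front pre b post       =
  unextend-front (suc n) pre b post (AllP.concat⁻ (entries-< valid)) (All-middle pre ne) (linked⇒sorted linked)
... | inner pre x us vs post =
  unextend-inner (suc n) pre x us vs post (AllP.concat⁻ (entries-< valid)) ne (linked⇒sorted linked)

extensions-disjoint : ∀ n π₁ π₂ e → IsSLP n π₁ → IsSLP n π₂ →
  e ∈ extensions (suc n) π₁ → e ∈ extensions (suc n) π₂ → π₁ ≡ π₂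
extensions-disjoint n π₁ π₂ e valid₁ valid₂ e∈₁ e∈₂ =
  trans (sym (unextend-extensions n π₁ e valid₁ e∈₁)) (unextend-extensions n π₂ e valid₂ e∈₂)

m∈insTail : ∀ {m} b {b′} → b′ ∈ insTail m b → m ∈ b′
m∈insTail b b′∈ with insTail⁻ b b′∈
... | afterHead x us vs = there (∈-++⁺ʳ us (here refl))

first-insTail : ∀ {m} b {b′} → b′ ∈ insTail m b → first b′ ≡ first b
first-insTail b b′∈ with insTail⁻ b b′∈
... | afterHead x us vs = refl

∉-above : ∀ {m} {b : Block} → All (_< m) b → m ∈ b → ⊥
∉-above b<m m∈b = <-irrefl refl (All.lookup b<m m∈b)

insEvery-unique : ∀ m xs → All (_< m) xs → Unique (insEvery m xs)
insEvery-unique m []       []           = [] ∷ []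
insEvery-unique m (y ∷ ys) (y<m ∷ ys<m) =
  All.tabulate m-first≢ ∷ Unique.map⁺ ∷-injectiveʳ (insEvery-unique m ys ys<m)
  where m-first≢ : ∀ {w} → w ∈ map (y ∷_) (insEvery m ys) → (m ∷ y ∷ ys) ≢ w
        m-first≢ w∈ eq with ∈-map⁻ (y ∷_) w∈
        ... | _ , _ , refl = <-irrefl (sym (∷-injectiveˡ eq)) y<m

insTail-unique : ∀ {m} b → All (_< m) b → Unique (insTail m b)
insTail-unique     []       []         = []
insTail-unique {m} (x ∷ xs) (_ ∷ xs<m) = Unique.map⁺ ∷-injectiveʳ (insEvery-unique m xs xs<m)

-- Putting m in front of b differs from inserting it into b after its head (the head
-- changes) or into a later block c (c would have to contain m, or b would be c).
front-fresh : ∀ m b π → All (_< m) b → All (All (_< m)) π → NonEmpty b → All (b ≺_) π →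
  All ((π ++ [ m ∷ b ]) ≢_) (map (_∷ π) (insTail m b) ++ map (b ∷_) (insAll m π))
front-fresh m b [] b<m _ (nonEmpty x xs) _ = All.tabulate distinct
  where
  distinct : ∀ {e} → e ∈ map (_∷ []) (insTail m b) ++ [] → [ m ∷ b ] ≢ e
  distinct e∈ eq with ∈-map⁻ (_∷ []) (subst (_ ∈_) (++-identityʳ _) e∈)
  ... | b′ , b′∈ , refl =
    <-irrefl (sym (trans (cong first (∷-injectiveˡ eq)) (first-insTail b b′∈))) (All.head b<m)
front-fresh m b (c ∷ π) b<m (c<m ∷ _) _ (b≺c ∷ _) = All.tabulate distinct
  where
  distinct : ∀ {e} → e ∈ map (_∷ c ∷ π) (insTail m b) ++ map (b ∷_) (insAll m (c ∷ π)) →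
    (c ∷ π ++ [ m ∷ b ]) ≢ e
  distinct e∈ eq with ∈-++⁻ (map (_∷ c ∷ π) (insTail m b)) e∈
  ... | inj₁ e∈ₗ with b′ , b′∈ , refl ← ∈-map⁻ (_∷ c ∷ π) e∈ₗ =
    ∉-above c<m (subst (m ∈_) (sym (∷-injectiveˡ eq)) (m∈insTail b b′∈))
  ... | inj₂ e∈ᵣ with _ , _ , refl ← ∈-map⁻ (b ∷_) e∈ᵣ =
    <-irrefl (cong first (sym (∷-injectiveˡ eq))) b≺c

insAll-unique : ∀ m π → All NonEmpty π → All (All (_< m)) π → Sorted π → Unique (insAll m π)
insAll-unique m []      []            []            []               = []
insAll-unique m (b ∷ π) (b-ne ∷ π-ne) (b<m ∷ π<m) (b≺π ∷ π-sorted) =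
  front-fresh m b π b<m π<m b-ne b≺π ∷ Unique.++⁺ into-b-unique into-π-unique disjoint
  where
  into-b-unique : Unique (map (_∷ π) (insTail m b))
  into-b-unique = Unique.map⁺ ∷-injectiveˡ (insTail-unique b b<m)
  into-π-unique : Unique (map (b ∷_) (insAll m π))
  into-π-unique = Unique.map⁺ ∷-injectiveʳ (insAll-unique m π π-ne π<m π-sorted)
  -- the first block contains m on the left but is b on the right
  disjoint : ∀ {e} → ¬ (e ∈ map (_∷ π) (insTail m b) × e ∈ map (b ∷_) (insAll m π))
  disjoint (e∈ₗ , e∈ᵣ) with b′ , b′∈ , refl ← ∈-map⁻ (_∷ π) e∈ₗ
                        with _ , _ , eq ← ∈-map⁻ (b ∷_) e∈ᵣ =
    ∉-above b<m (subst (m ∈_) (∷-injectiveˡ eq) (m∈insTail b b′∈))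

-- The singleton extension has one block more than the others.
extensions-unique : ∀ n π → IsSLP n π → Unique (extensions (suc n) π)
extensions-unique n π valid@(ne , _ , linked) =
  All.tabulate more-blocks ∷ insAll-unique (suc n) π ne (AllP.concat⁻ (entries-< valid)) (linked⇒sorted linked)
  where
  more-blocks : ∀ {e} → e ∈ insAll (suc n) π → (π ++ [ [ suc n ] ]) ≢ e
  more-blocks {e} e∈ eq = m+1+n≢m (length π) (begin
    length π + 1               ≡⟨ sym (length-++ π) ⟩
    length (π ++ [ [ suc n ] ]) ≡⟨ cong length eq ⟩
    length e                   ≡⟨ length-blockInsertion (insAll⁻ π e∈) ⟩
    length π                   ∎)

concatMap-unique : ∀ (g : A → List B) (V : A → Set) xs → Unique xs → All V xs →
  (∀ x → V x → Unique (g x)) → (∀ x y {e} → V x → V y → e ∈ g x → e ∈ g y → x ≡ y) →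
  Unique (concatMap g xs)
concatMap-unique g V []       _            _            _        _        = []
concatMap-unique g V (x ∷ xs) (x∉xs ∷ uniq) (vx ∷ vxs) g-unique disjoint =
  Unique.++⁺ (g-unique x vx) (concatMap-unique g V xs uniq vxs g-unique disjoint) separated
  where separated : ∀ {e} → ¬ (e ∈ g x × e ∈ concatMap g xs)
        separated (e∈gx , e∈rest) with y , y∈xs , e∈gy ← find (∈-concatMap⁻ g e∈rest) =
          All.lookup x∉xs y∈xs (disjoint x y vx (All.lookup vxs y∈xs) e∈gx e∈gy)

SLP₀ : ∀ π → IsSLP 0 π → π ≡ []
SLP₀ []              _                          = refl
SLP₀ ((x ∷ xs) ∷ π) (nonEmpty x xs ∷ _ , ↭[] , _) with () ← ↭-empty-inv ↭[]

slp-enumerates : ∀ n → Enumerates n (slp n)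
slp-enumerates zero = [] ∷ [] , λ π → mk⇔ (λ { (here refl) → [] , ↭-refl , [] }) (λ valid → here (SLP₀ π valid))
slp-enumerates (suc n) with uniq , members ← slp-enumerates n =
  concatMap-unique (extensions (suc n)) (IsSLP n) (slp n) uniq (All.tabulate (Equivalence.to (members _)))
                   (extensions-unique n) (λ π₁ π₂ → extensions-disjoint n π₁ π₂ _) ,
  λ e → mk⇔ (valid e) (listed e)
  where
  valid : ∀ e → e ∈ slp (suc n) → IsSLP (suc n) e
  valid e e∈ with π , π∈ , e∈ext ← find (∈-concatMap⁻ (extensions (suc n)) e∈) =
    extensions-valid n π e (Equivalence.to (members π) π∈) e∈ext
  listed : ∀ e → IsSLP (suc n) e → e ∈ slp (suc n)
  listed e e-valid with π , π-valid , e∈ext ← restriction n e e-valid =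
    ∈-concatMap⁺ (extensions (suc n)) (lose (Equivalence.from (members π) π-valid) e∈ext)

slp-valid : ∀ n {π} → π ∈ slp n → IsSLP n π
slp-valid n π∈ = Equivalence.to (proj₂ (slp-enumerates n) _) π∈

slp-byBlocks : ∀ n (f : ℕ → ℕ) → sum (map (λ π → f (length π)) (slp n)) ≡ stir1Sum n (λ j → stir2Sum j f)
slp-byBlocks zero    f = base (f 0)
  where base : ∀ a → a + 0 ≡ 1 * (1 * a + 0) + 0
        base = solve-∀
slp-byBlocks (suc n) f = begin
  sum (map (λ e → f (length e)) (concatMap (extensions (suc n)) (slp n)))
    ≡⟨ sum-concatMap (extensions (suc n)) (λ e → f (length e)) (slp n) ⟩
  sum (map (λ π → sum (map (λ e → f (length e)) (extensions (suc n) π))) (slp n))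
    ≡⟨ sum-map-cong (slp n) (λ π π∈ → trans (extensions-byBlocks (suc n) π f)
                                           (cong (λ s → grow s f (length π)) (size-SLP (slp-valid n π∈)))) ⟩
  sum (map (λ π → grow n f (length π)) (slp n))
    ≡⟨ slp-byBlocks n (grow n f) ⟩
  stir1Sum n (λ j → stir2Sum j (grow n f))
    ≡⟨ stir1Sum-grow n f ⟩
  stir1Sum (suc n) (λ j → stir2Sum j f)  ∎

slp-nse : ∀ n (f : ℕ → ℕ) → sum (map (λ π → nse π * f (length π)) (slp n)) ≡ defectSum n (λ j → stir2Sum j f)
slp-nse zero    f = refl
slp-nse (suc n) f = begin
  sum (map (λ e → nse e * f (length e)) (concatMap (extensions (suc n)) (slp n)))
    ≡⟨ sum-concatMap (extensions (suc n)) (λ e → nse e * f (length e)) (slp n) ⟩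
  sum (map (λ π → sum (map (λ e → nse e * f (length e)) (extensions (suc n) π))) (slp n))
    ≡⟨ sum-map-cong (slp n) (λ π π∈ → trans (extensions-nse (suc n) π f (proj₁ (slp-valid n π∈)) (entries-< (slp-valid n π∈)))
                                           (cong (λ s → nse π * grow s f (length π) + s * f (length π)) (size-SLP (slp-valid n π∈)))) ⟩
  sum (map (λ π → nse π * grow n f (length π) + n * f (length π)) (slp n))
    ≡⟨ sum-map-+ (slp n) (λ π → nse π * grow n f (length π)) (λ π → n * f (length π)) ⟩
  sum (map (λ π → nse π * grow n f (length π)) (slp n)) + sum (map (λ π → n * f (length π)) (slp n))
    ≡⟨ cong₂ _+_ (slp-nse n (grow n f)) (trans (sum-map-*ˡ (slp n) n (λ π → f (length π))) (cong (n *_) (slp-byBlocks n f))) ⟩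
  defectSum n (λ j → stir2Sum j (grow n f)) + n * stir1Sum n (λ j → stir2Sum j f)
    ≡⟨ defectSum-grow n f ⟩
  defectSum (suc n) (λ j → stir2Sum j f)  ∎

slp-count : ∀ n → length (slp n) ≡ stir1Sum n (λ k → stir2Sum k one)
slp-count n = trans (sym (trans (sum-map-const (slp n) 1) (*-identityʳ (length (slp n))))) (slp-byBlocks n one)

slp-total-nse : ∀ n → sum (map nse (slp n)) ≡ defectSum n (λ k → stir2Sum k one)
slp-total-nse n = trans (sum-map-cong (slp n) (λ π _ → sym (*-identityʳ (nse π)))) (slp-nse n one)

enumerations-↭ : ∀ {n L L′} → Enumerates n L → Enumerates n L′ → L ↭ L′
enumerations-↭ (uniq , members) (uniq′ , members′) =
  ∼bag⇒↭ (unique∧set⇒bag uniq uniq′ (λ {π} →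
    mk⇔ (Equivalence.from (members′ π) ∘ Equivalence.to (members π))
        (Equivalence.from (members π) ∘ Equivalence.to (members′ π))))

mainTheorem3 : (n : ℕ) → 1 ≤ n → (L : List SL) → Enumerates n L →
    sum (map nse L) * denom n ≡ numer n * length L
mainTheorem3 n _ L L-enumerates = begin
  sum (map nse L) * denom n                       ≡⟨ cong₂ _*_ (sum-↭ (map⁺ nse L↭slp)) (denom≡stir1Sum n) ⟩
  sum (map nse (slp n)) * G                       ≡⟨ cong (_* G) (slp-total-nse n) ⟩
  H * G                                           ≡⟨ cong (H *_) (sym (slp-count n)) ⟩
  H * length (slp n)                              ≡⟨ cong₂ _*_ (sym (numer≡defectSum n)) (sym (↭-length L↭slp)) ⟩
  numer n * length L                              ∎
  where
  G H : ℕ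
  G = stir1Sum n (λ k → stir2Sum k one)
  H = defectSum n (λ k → stir2Sum k one)
  L↭slp : L ↭ slp n
  L↭slp = enumerations-↭ L-enumerates (slp-enumerates n)
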